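{- Let $G$ be a graph without isolated vertices, and let $H$ be obtained from $G$ by adding a new vertex $v$ adjacent to some (at least one) or all vertices of $G$. Then $\chi_o(H)\le \chi_o(G)+2$.
   Context: All graphs are finite, simple and undirected. A proper vertex coloring $\varphi$ of a graph $G$ is called an odd coloring if for every non-isolated vertex $x$ of $G$ there is a color $c$ such that the number of neighbors $y\in N(x)$ with $\varphi(y)=c$ is odd. The odd chromatic number $\chi_o(G)$ is the minimum number of colors in an odd coloring of $G$. -}

module Defs where

open import Data.Nat using (ℕ; zero; suc; _<_; _%_)
open import Data.Bool using (Bool; true; false; _∧_; if_then_else_)
open import Data.Fin using (Fin; zero; suc; _≟_)
open import Data.List using (List; length; filterᵇ; allFin)
open import Data.Product using (Σ; ∃; ∃-syntax; _×_)
open import Relation.Nullary using (¬_; does)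
open import Relation.Binary.PropositionalEquality using (_≡_; _≢_)

record Graph (n : ℕ) : Set where
  field
    adj    : Fin n → Fin n → Bool
    sym    : ∀ x y → adj x y ≡ adj y x
    irrefl : ∀ x → adj x x ≡ false
open Graph public

NonIsolated : ∀ {n} → Graph n → Fin n → Set
NonIsolated G x = ∃[ y ] (adj G x y ≡ true)

NoIsolatedVertices : ∀ {n} → Graph n → Set
NoIsolatedVertices G = ∀ x → NonIsolated G x

colorCount : ∀ {n k} → Graph n → (Fin n → Fin k) → Fin n → Fin k → ℕ
colorCount {n} G φ x c =
  length (filterᵇ (λ y → adj G x y ∧ does (φ y ≟ c)) (allFin n))

IsOddColoring : ∀ {n k} → Graph n → (Fin n → Fin k) → Set
IsOddColoring G φ =
  (∀ x y → adj G x y ≡ true → φ x ≢ φ y)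
  × (∀ x → NonIsolated G x → ∃[ c ] (colorCount G φ x c % 2 ≡ 1))

OddColorable : ∀ {n} → Graph n → ℕ → Set
OddColorable {n} G k = Σ (Fin n → Fin k) (IsOddColoring G)

IsOddChromaticNumber : ∀ {n} → Graph n → ℕ → Set
IsOddChromaticNumber G χ = OddColorable G χ × (∀ j → j < χ → ¬ OddColorable G j)

-- H = G plus a new vertex v (= zero), adjacent exactly to the vertices i with S i ≡ true
addVertex : ∀ {n} → Graph n → (Fin n → Bool) → Graph (suc n)
addVertex {n} G S = record { adj = a ; sym = s ; irrefl = r }
  where
    a : Fin (suc n) → Fin (suc n) → Bool
    a zero zero = false
    a zero (suc j) = S j
    a (suc i) zero = S i
    a (suc i) (suc j) = adj G i j
    s : ∀ x y → a x y ≡ a y x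
    s zero zero = Relation.Binary.PropositionalEquality.refl
    s zero (suc j) = Relation.Binary.PropositionalEquality.refl
    s (suc i) zero = Relation.Binary.PropositionalEquality.refl
    s (suc i) (suc j) = sym G i j
    r : ∀ x → a x x ≡ false
    r zero = Relation.Binary.PropositionalEquality.refl
    r (suc i) = irrefl G i

{-# OPTIONS --safe #-}
module Submission where

-- Give the new vertex v a fresh color, one neighbor u of v a second fresh
-- color, and keep the old coloring (shifted past the two new colors)
-- elsewhere. Then v sees u's color exactly once, every neighbor of v sees v's
-- color exactly once, every neighbor of u sees u's color exactly once, and
-- any other vertex has the same neighborhood and color multiplicities as in
-- G, so it keeps its odd color.

open import Defs hiding (sym)
open import Data.Nat using (ℕ; suc; _≤_; _+_; _%_)
open import Data.Nat.Properties using (≮⇒≥; +-comm)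
open import Data.Bool using (Bool; true; false; _∧_; if_then_else_)
open import Data.Bool.Properties using (¬-not; not-¬) renaming (_≟_ to _≟ᵇ_)
open import Data.Fin using (Fin; zero; suc; _≟_)
open import Data.Fin.Properties using (suc-injective; 0≢1+n)
open import Data.List using (length; filterᵇ; tabulate)
open import Data.Product using (∃-syntax; _,_; proj₁; proj₂)
open import Data.Empty using (⊥-elim)
open import Function using (_∘_; id)
open import Function.Definitions using (Injective)
open import Relation.Nullary using (does; yes; no)
open import Relation.Binary.PropositionalEquality
  using (_≡_; _≢_; refl; sym; trans; cong; subst)
open Relation.Binary.PropositionalEquality.≡-Reasoning

count : ∀ {m} → (Fin m → Bool) → ℕ
count {ℕ.zero} p = 0
count {suc m}  p = if p zero then suc (count (p ∘ suc)) else count (p ∘ suc)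

length-filterᵇ-tabulate : ∀ {A : Set} {m} (p : A → Bool) (f : Fin m → A) →
  length (filterᵇ p (tabulate f)) ≡ count (p ∘ f)
length-filterᵇ-tabulate {m = ℕ.zero} p f = refl
length-filterᵇ-tabulate {m = suc m} p f with p (f zero)
... | true  = cong suc (length-filterᵇ-tabulate p (f ∘ suc))
... | false = length-filterᵇ-tabulate p (f ∘ suc)

count-cong : ∀ {m} {p q : Fin m → Bool} → (∀ y → p y ≡ q y) → count p ≡ count q
count-cong {ℕ.zero} p≡q = refl
count-cong {suc m} {p} {q} p≡q rewrite p≡q zero | count-cong (p≡q ∘ suc) = refl

count-const-false : ∀ {m} (p : Fin m → Bool) → (∀ y → p y ≡ false) → count p ≡ 0
count-const-false {ℕ.zero} p p≡false = refl
count-const-false {suc m} p p≡false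
  rewrite p≡false zero = count-const-false (p ∘ suc) (p≡false ∘ suc)

count-singleton : ∀ {m} (p : Fin m → Bool) (y : Fin m) → p y ≡ true →
  (∀ z → p z ≡ true → z ≡ y) → count p ≡ 1
count-singleton p zero py unique rewrite py =
  cong suc (count-const-false (p ∘ suc)
    (λ z → ¬-not (0≢1+n ∘ sym ∘ unique (suc z))))
count-singleton p (suc y) py unique
  rewrite ¬-not {p zero} (0≢1+n ∘ unique zero) =
  count-singleton (p ∘ suc) y py (λ z → suc-injective ∘ unique (suc z))

colorCount≡count : ∀ {n k} (G : Graph n) (φ : Fin n → Fin k) x c →
  colorCount G φ x c ≡ count (λ y → adj G x y ∧ does (φ y ≟ c))
colorCount≡count G φ x c = length-filterᵇ-tabulate (λ y → adj G x y ∧ does (φ y ≟ c)) id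

∧-true⇒ʳ : ∀ {a b} → a ∧ b ≡ true → b ≡ true
∧-true⇒ʳ {true} b≡true = b≡true

does-≟⇒≡ : ∀ {m} {a b : Fin m} → does (a ≟ b) ≡ true → a ≡ b
does-≟⇒≡ {a = a} {b} d with a ≟ b
... | yes a≡b = a≡b

does-≟-refl : ∀ {m} (a : Fin m) → does (a ≟ a) ≡ true
does-≟-refl a with a ≟ a
... | yes _   = refl
... | no a≢a = ⊥-elim (a≢a refl)

does-≟-injective : ∀ {m k} {f : Fin m → Fin k} → Injective _≡_ _≡_ f →
  ∀ a b → does (f a ≟ f b) ≡ does (a ≟ b)
does-≟-injective {f = f} inj a b with a ≟ b | f a ≟ f b
... | yes _   | yes _     = refl
... | no _    | no _      = refl
... | yes a≡b | no fa≢fb  = ⊥-elim (fa≢fb (cong f a≡b))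
... | no a≢b  | yes fa≡fb = ⊥-elim (a≢b (inj fa≡fb))

colorCount-singleton : ∀ {n k} (G : Graph n) (φ : Fin n → Fin k) {x y c} →
  adj G x y ≡ true → φ y ≡ c → (∀ z → φ z ≡ c → z ≡ y) →
  colorCount G φ x c ≡ 1
colorCount-singleton G φ {x} {y} {c} xy φy≡c unique =
  trans (colorCount≡count G φ x c)
    (count-singleton _ y
      (subst (λ b → b ∧ does (φ y ≟ c) ≡ true) (sym xy)
        (subst (λ d → does (d ≟ c) ≡ true) (sym φy≡c) (does-≟-refl c)))
      (λ z → unique z ∘ does-≟⇒≡ ∘ ∧-true⇒ʳ {adj G x z}))

singletonColorNeighbour⇒odd : ∀ {n k} (G : Graph n) (φ : Fin n → Fin k) x y {c} →
  adj G x y ≡ true → φ y ≡ c → (∀ z → φ z ≡ c → z ≡ y) →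
  ∃[ c ] (colorCount G φ x c % 2 ≡ 1)
singletonColorNeighbour⇒odd G φ x y {c} xy φy≡c unique =
  c , cong (_% 2) (colorCount-singleton G φ xy φy≡c unique)

colorCount-relabel : ∀ {n k l} (G : Graph n) (φ : Fin n → Fin k) (φ′ : Fin n → Fin l)
  {f : Fin k → Fin l} → Injective _≡_ _≡_ f → ∀ x →
  (∀ y → adj G x y ≡ true → φ′ y ≡ f (φ y)) →
  ∀ c → colorCount G φ′ x (f c) ≡ colorCount G φ x c
colorCount-relabel G φ φ′ {f} inj x agree c = begin
  colorCount G φ′ x (f c)                         ≡⟨ colorCount≡count G φ′ x (f c) ⟩
  count (λ y → adj G x y ∧ does (φ′ y ≟ f c))     ≡⟨ count-cong pointwise ⟩
  count (λ y → adj G x y ∧ does (φ y ≟ c))        ≡⟨ sym (colorCount≡count G φ x c) ⟩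
  colorCount G φ x c                              ∎
  where
  pointwise : ∀ y → adj G x y ∧ does (φ′ y ≟ f c) ≡ adj G x y ∧ does (φ y ≟ c)
  pointwise y with adj G x y in xy
  ... | false = refl
  ... | true  = trans (cong (λ d → does (d ≟ f c)) (agree y xy))
                      (does-≟-injective inj (φ y) c)

colorCount-addVertex-nonNeighbour : ∀ {n k} (G : Graph n) (S : Fin n → Bool)
  (ψ : Fin (suc n) → Fin k) {w} → S w ≡ false →
  ∀ c → colorCount (addVertex G S) ψ (suc w) c ≡ colorCount G (ψ ∘ suc) w c
colorCount-addVertex-nonNeighbour G S ψ {w} Sw c = begin
  colorCount (addVertex G S) ψ (suc w) c
    ≡⟨ colorCount≡count (addVertex G S) ψ (suc w) c ⟩
  (if S w ∧ does (ψ zero ≟ c) then suc restCount else restCount)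
    ≡⟨ cong (λ b → if b ∧ does (ψ zero ≟ c) then suc restCount else restCount) Sw ⟩
  restCount
    ≡⟨ sym (colorCount≡count G (ψ ∘ suc) w c) ⟩
  colorCount G (ψ ∘ suc) w c ∎
  where
  restCount : ℕ
  restCount = count (λ y → adj G w y ∧ does (ψ (suc y) ≟ c))

nonIsolated-addVertex-nonNeighbour : ∀ {n} (G : Graph n) (S : Fin n → Bool) {w} →
  S w ≡ false → NonIsolated (addVertex G S) (suc w) → NonIsolated G w
nonIsolated-addVertex-nonNeighbour G S Sw (zero , Sw≡true) =
  ⊥-elim (not-¬ Sw Sw≡true)
nonIsolated-addVertex-nonNeighbour G S Sw (suc y , wy) = y , wy

module ExtendColoring {n k} (G : Graph n) (S : Fin n → Bool)
  (u : Fin n) (Su : S u ≡ true) (φ : Fin n → Fin k) (odd : IsOddColoring G φ) where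

  H : Graph (suc n)
  H = addVertex G S

  ψ : Fin (suc n) → Fin (2 + k)
  ψ zero = zero
  ψ (suc w) with w ≟ u
  ... | yes _ = suc zero
  ... | no _  = suc (suc (φ w))

  ψ-u : ψ (suc u) ≡ suc zero
  ψ-u with u ≟ u
  ... | yes _   = refl
  ... | no u≢u = ⊥-elim (u≢u refl)

  ψ-other : ∀ w → w ≢ u → ψ (suc w) ≡ suc (suc (φ w))
  ψ-other w w≢u with w ≟ u
  ... | yes w≡u = ⊥-elim (w≢u w≡u)
  ... | no _    = refl

  ψ≡0⇒ : ∀ z → ψ z ≡ zero → z ≡ zero
  ψ≡0⇒ zero _ = refl
  ψ≡0⇒ (suc w) _ with w ≟ u
  ψ≡0⇒ (suc w) () | yes _
  ψ≡0⇒ (suc w) () | no _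

  ψ≡1⇒ : ∀ z → ψ z ≡ suc zero → z ≡ suc u
  ψ≡1⇒ zero ()
  ψ≡1⇒ (suc w) ψw≡1 with w ≟ u
  ψ≡1⇒ (suc w) ψw≡1 | yes w≡u = cong suc w≡u
  ψ≡1⇒ (suc w) ()   | no _

  proper : ∀ x y → adj H x y ≡ true → ψ x ≢ ψ y
  proper zero    zero    ()
  proper zero    (suc w) _ ψ≡ = 0≢1+n (sym (ψ≡0⇒ (suc w) (sym ψ≡)))
  proper (suc w) zero    _ ψ≡ = 0≢1+n (sym (ψ≡0⇒ (suc w) ψ≡))
  proper (suc w) (suc w′) ww′ ψ≡ with w ≟ u | w′ ≟ u
  ... | yes refl | yes refl = not-¬ (irrefl G u) ww′
  proper (suc w) (suc w′) ww′ () | yes _ | no _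
  proper (suc w) (suc w′) ww′ () | no _  | yes _
  ... | no _ | no _ = proj₁ odd w w′ ww′ (suc-injective (suc-injective ψ≡))

  oddAwayFromNew : ∀ w → S w ≡ false → adj G w u ≡ false → NonIsolated G w →
    ∃[ c ] (colorCount H ψ (suc w) c % 2 ≡ 1)
  oddAwayFromNew w Sw wu nonIso with proj₂ odd w nonIso
  ... | c , oddc = suc (suc c) , (begin
    colorCount H ψ (suc w) (suc (suc c)) % 2
      ≡⟨ cong (_% 2) (colorCount-addVertex-nonNeighbour G S ψ Sw (suc (suc c))) ⟩
    colorCount G (ψ ∘ suc) w (suc (suc c)) % 2
      ≡⟨ cong (_% 2) (colorCount-relabel G φ (ψ ∘ suc) (suc-injective ∘ suc-injective)
           w agree c) ⟩
    colorCount G φ w c % 2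
      ≡⟨ oddc ⟩
    1 ∎)
    where
    agree : ∀ y → adj G w y ≡ true → ψ (suc y) ≡ suc (suc (φ y))
    agree y wy = ψ-other y (λ { refl → not-¬ wu wy })

  oddH : ∀ x → NonIsolated H x → ∃[ c ] (colorCount H ψ x c % 2 ≡ 1)
  oddH zero _ = singletonColorNeighbour⇒odd H ψ zero (suc u) Su ψ-u ψ≡1⇒
  oddH (suc w) nonIso with w ≟ u
  ... | yes refl = singletonColorNeighbour⇒odd H ψ (suc u) zero Su refl ψ≡0⇒
  ... | no _ with adj G w u ≟ᵇ true | S w ≟ᵇ true
  ... | yes wu | _      = singletonColorNeighbour⇒odd H ψ (suc w) (suc u) wu ψ-u ψ≡1⇒
  ... | no _   | yes Sw = singletonColorNeighbour⇒odd H ψ (suc w) zero Sw refl ψ≡0⇒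
  ... | no ¬wu | no ¬Sw =
    oddAwayFromNew w (¬-not ¬Sw) (¬-not ¬wu)
      (nonIsolated-addVertex-nonNeighbour G S (¬-not ¬Sw) nonIso)

  oddColoring : IsOddColoring H ψ
  oddColoring = proper , oddH

oddColorable-addVertex : ∀ {n k} (G : Graph n) (S : Fin n → Bool) →
  ∃[ u ] (S u ≡ true) → OddColorable G k → OddColorable (addVertex G S) (2 + k)
oddColorable-addVertex G S (u , Su) (φ , odd) =
  ExtendColoring.ψ G S u Su φ odd , ExtendColoring.oddColoring G S u Su φ odd

oddChromaticNumber-minimal : ∀ {n} (G : Graph n) {χ k} →
  IsOddChromaticNumber G χ → OddColorable G k → χ ≤ k
oddChromaticNumber-minimal G (_ , minimal) colorable =
  ≮⇒≥ (λ k<χ → minimal _ k<χ colorable)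

mainTheorem3 : ∀ {n} (G : Graph n) → NoIsolatedVertices G →
    (S : Fin n → Bool) → ∃[ i ] (S i ≡ true) →
    (χG χH : ℕ) → IsOddChromaticNumber G χG →
    IsOddChromaticNumber (addVertex G S) χH → χH ≤ χG + 2
mainTheorem3 G _ S hasNeighbour χG χH (colorableG , _) χH-minimal =
  subst (χH ≤_) (+-comm 2 χG)
    (oddChromaticNumber-minimal (addVertex G S) χH-minimal
      (oddColorable-addVertex G S hasNeighbour colorableG))
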